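{- Let $P$ be a self-dual poset and let $\mathcal{O}$ be a swap-closed promotion orbit of elements of $\mathrm{Inc}^q(P)$. Then, $\mathcal{O}$ exhibits orbitmesy with respect to the antipodal sum statistic $\mathcal{A}_x$ for all $x \in P$ and with respect to the total sum statistic $\mathrm{Tot}$.
   Context: $P$ is a finite self-dual poset with a fixed order-reversing involution $\kappa:P\to P$. $\mathrm{Inc}^q(P)$ is the set of increasing labelings $f:P\to[q]$ ($f(x)<f(y)$ whenever $x<y$). Promotion $\mathrm{Pro}$ on $\mathrm{Inc}^q(P)$: replace every label $1$ by an empty box; for $i=2,\dots,q$ in turn slide boxes up (a box at $x$ becomes $i$ if some $y\gtrdot x$ is labeled $i$, and that element labeled $i$ becomes a box); then replace boxes by $q+1$ and subtract $1$ from every label. $\mathrm{swap}(f)(x)=q+1-f(\kappa(x))$; swap sends each promotion orbit onto a single promotion orbit, and an orbit $\mathcal{O}$ is swap-closed if $\mathrm{swap}(\mathcal{O})=\mathcal{O}$. $\mathcal{A}_x(f)=f(x)+f(\kappa(x))$ and $\mathrm{Tot}(f)=\sum_{x\in P}f(x)$. An orbit is orbitmesic with respect to a statistic if its average value of the statistic equals the average over all of $\mathrm{Inc}^q(P)$. -}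

module Defs where

open import Data.Nat using (ℕ; zero; suc; _+_; _*_; _∸_; _≤_; _<_; _≡ᵇ_)
open import Data.Nat.Properties using (_≤?_; _<?_)
open import Data.Bool using (Bool; true; false; if_then_else_; _∧_; not)
open import Data.Fin using (Fin)
open import Data.Fin.Properties using (all?)
open import Data.Vec using (Vec; []; _∷_; lookup; tabulate; toList)
open import Data.List using (List; []; _∷_; map; concatMap; upTo; allFin; filter; length; foldl)
open import Data.Bool.ListAction using (any)
open import Data.Nat.ListAction using (sum)
open import Data.Product using (_×_; _,_)
open import Function using (_∘_)
open import Relation.Nullary using (Dec; ¬_; _×-dec_; _→-dec_)
open import Relation.Nullary.Decidable using (⌊_⌋)
open import Relation.Binary using (Rel; Decidable; IsStrictPartialOrder)
open import Relation.Binary.PropositionalEquality using (_≡_)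

record SelfDualPoset (n : ℕ) : Set₁ where
  field
    _≺_        : Rel (Fin n) _
    ≺-dec      : Decidable _≺_
    isStrictPO : IsStrictPartialOrder _≡_ _≺_
    κ          : Fin n → Fin n
    κ-invol    : ∀ x → κ (κ x) ≡ x
    κ-reverse  : ∀ x y → x ≺ y → κ y ≺ κ x

module _ {n : ℕ} (P : SelfDualPoset n) (q : ℕ) where
  open SelfDualPoset P

  Labeling : Set
  Labeling = Vec ℕ n

  IsIncreasing : Labeling → Set
  IsIncreasing f = (∀ x → (1 ≤ lookup f x) × (lookup f x ≤ q))
                 × (∀ x y → x ≺ y → lookup f x < lookup f y)

  isIncreasing? : ∀ f → Dec (IsIncreasing f)
  isIncreasing? f =
    all? (λ x → (1 ≤? lookup f x) ×-dec (lookup f x ≤? q))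
    ×-dec all? (λ x → all? (λ y → ≺-dec x y →-dec (lookup f x <? lookup f y)))

  allLabelings : (m : ℕ) → List (Vec ℕ m)
  allLabelings zero = [] ∷ []
  allLabelings (suc m) =
    concatMap (λ a → map (a ∷_) (allLabelings m)) (map suc (upTo q))

  Inc : List Labeling
  Inc = filter isIncreasing? (allLabelings n)

  _⋖ᵇ_ : Fin n → Fin n → Bool
  x ⋖ᵇ y = ⌊ ≺-dec x y ⌋ ∧ not (any (λ z → ⌊ ≺-dec x z ⌋ ∧ ⌊ ≺-dec z y ⌋) (allFin n))

  -- During the procedure an empty box is encoded by the value 0.
  -- Step i: a box at x becomes i if some y covering x is labeled i, and every
  -- element labeled i covering a box becomes a box (simultaneously).
  proStep : ℕ → Labeling → Labeling
  proStep i g = tabulate λ x →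
    if (lookup g x ≡ᵇ 0) ∧ any (λ y → (x ⋖ᵇ y) ∧ (lookup g y ≡ᵇ i)) (allFin n)
    then i
    else (if (lookup g x ≡ᵇ i) ∧ any (λ z → (z ⋖ᵇ x) ∧ (lookup g z ≡ᵇ 0)) (allFin n)
          then 0
          else lookup g x)

  Pro : Labeling → Labeling
  Pro f = finish (foldl (λ g i → proStep i g) start (map (2 +_) (upTo (q ∸ 1))))
    where
    start : Labeling
    start = tabulate λ x → if lookup f x ≡ᵇ 1 then 0 else lookup f x
    finish : Labeling → Labeling
    finish g = tabulate λ x → if lookup g x ≡ᵇ 0 then q else lookup g x ∸ 1

  Pro^ : ℕ → Labeling → Labeling
  Pro^ zero f = f
  Pro^ (suc k) f = Pro (Pro^ k f)

  swap : Labeling → Labeling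
  swap f = tabulate λ x → suc q ∸ lookup f (κ x)

  antipodal : Fin n → Labeling → ℕ
  antipodal x f = lookup f x + lookup f (κ x)

  Tot : Labeling → ℕ
  Tot f = sum (toList f)

  -- The promotion orbit of f, listed once: f, Pro f, …, Pro^(p-1) f,
  -- where p is the (exact) orbit size.
  orbit : Labeling → ℕ → List Labeling
  orbit f p = map (λ k → Pro^ k f) (upTo p)

  IsOrbitSize : Labeling → ℕ → Set
  IsOrbitSize f p = (0 < p) × (Pro^ p f ≡ f) × (∀ k → 0 < k → k < p → ¬ (Pro^ k f ≡ f))

  SwapClosed : Labeling → Set
  SwapClosed f = (∀ k → Data.Product.∃ λ j → swap (Pro^ k f) ≡ Pro^ j f)
               × (∀ k → Data.Product.∃ λ j → Pro^ k f ≡ swap (Pro^ j f))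

  -- Orbitmesy: (Σ_{g∈O} st g)/|O| = (Σ_{g∈Inc} st g)/|Inc|, cross-multiplied.
  Orbitmesic : (Labeling → ℕ) → Labeling → ℕ → Set
  Orbitmesic st f p = sum (map st (orbit f p)) * length Inc ≡ sum (map st Inc) * p

-- For st = A_x or Tot, st (swap g) + st g is a constant c, namely 2(q+1) or (q+1)|P|, since
-- swap replaces each label a by q+1-a and κ permutes P. Both Inc^q(P) and a swap-closed orbit
-- are finite sets on which swap is an involution, so pairing g with swap g shows that twice the
-- sum of st over either set is c times its size: st averages to c/2 on both. Nothing about
-- promotion beyond its iteration is used.
module Submission where

open import Defs
open import Data.Nat using (ℕ; zero; suc; _+_; _*_; _∸_; _≤_; _<_; s≤s; NonZero; >-nonZero; _%_; _/_)
open import Data.Nat.Properties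
open import Data.Nat.DivMod using (m≡m%n+[m/n]*n; m%n<n)
open import Data.Nat.ListAction using (sum)
open import Data.Nat.ListAction.Properties using (sum-↭)
open import Data.Fin as Fin using (Fin)
open import Data.Vec as Vec using (Vec; []; _∷_; lookup; toList)
import Data.Vec.Properties as Vec
open import Data.List as List using (List; []; _∷_; _++_; map; length; upTo; allFin; cartesianProductWith)
import Data.List.Properties as List
open import Data.List.Membership.Propositional using (_∈_)
open import Data.List.Membership.Propositional.Properties
open import Data.List.Membership.Propositional.Properties.WithK using (unique∧set⇒bag)
open import Data.List.Relation.Unary.Any using (here; there)
import Data.List.Relation.Unary.All as All
import Data.List.Relation.Unary.All.Properties as All
open import Data.List.Relation.Unary.AllPairs using ([]; _∷_)
open import Data.List.Relation.Unary.Unique.Propositional using (Unique)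
import Data.List.Relation.Unary.Unique.Propositional.Properties as Unique
open import Data.List.Relation.Binary.Permutation.Propositional using (_↭_)
import Data.List.Relation.Binary.Permutation.Propositional.Properties as ↭
open import Data.List.Relation.Binary.BagAndSetEquality using (∼bag⇒↭)
open import Data.Product using (_×_; _,_; proj₁; proj₂)
open import Data.Empty using (⊥-elim)
open import Function using (_∘_; id)
open import Function.Bundles using (mk⇔)
open import Relation.Binary using (tri<; tri≈; tri>)
open import Relation.Binary.PropositionalEquality
open import Algebra.Properties.CommutativeSemigroup +-commutativeSemigroup using (interchange)
open import Algebra.Properties.CommutativeSemigroup *-commutativeSemigroup using (xy∙z≈xz∙y)

module _ {A B : Set} {f : A → B} where

  unique-map : ∀ {xs} → (∀ {a b} → a ∈ xs → b ∈ xs → f a ≡ f b → a ≡ b) →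
               Unique xs → Unique (map f xs)
  unique-map {[]}     _   []          = []
  unique-map {x ∷ xs} inj (x∉xs ∷ xs!) =
    All.map⁺ (All.tabulate λ y∈xs fx≡fy → All.lookup x∉xs y∈xs (inj (here refl) (there y∈xs) fx≡fy))
    ∷ unique-map (λ a∈xs b∈xs → inj (there a∈xs) (there b∈xs)) xs!

sum-map-+-const : {A : Set} (h k : A → ℕ) (c : ℕ) (xs : List A) →
                  (∀ {x} → x ∈ xs → h x + k x ≡ c) →
                  sum (map h xs) + sum (map k xs) ≡ c * length xs
sum-map-+-const h k c []       _ = sym (*-zeroʳ c)
sum-map-+-const h k c (x ∷ xs) hk≡c = begin
  (h x + sum (map h xs)) + (k x + sum (map k xs)) ≡⟨ interchange (h x) _ (k x) _ ⟩
  (h x + k x) + (sum (map h xs) + sum (map k xs)) ≡⟨ cong₂ _+_ (hk≡c (here refl)) ih ⟩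
  c + c * length xs                               ≡⟨ *-suc c (length xs) ⟨
  c * suc (length xs)                             ∎
  where
  open ≡-Reasoning
  ih : sum (map h xs) + sum (map k xs) ≡ c * length xs
  ih = sum-map-+-const h k c xs (hk≡c ∘ there)

concatMap-map≡cartesianProductWith : {A B C : Set} (f : A → B → C) (xs : List A) (ys : List B) →
                                     List.concatMap (λ x → map (f x) ys) xs ≡ cartesianProductWith f xs ys
concatMap-map≡cartesianProductWith f []       ys = refl
concatMap-map≡cartesianProductWith f (x ∷ xs) ys =
  cong (map (f x) ys ++_) (concatMap-map≡cartesianProductWith f xs ys)

toList≡tabulate-lookup : ∀ {A : Set} {m} (v : Vec A m) → toList v ≡ List.tabulate (lookup v)
toList≡tabulate-lookup []      = refl
toList≡tabulate-lookup (a ∷ v) = cong (a ∷_) (toList≡tabulate-lookup v)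

record InvolutionOn {A : Set} (s : A → A) (xs : List A) : Set where
  field
    distinct   : Unique xs
    closed     : ∀ {x} → x ∈ xs → s x ∈ xs
    involutive : ∀ {x} → x ∈ xs → s (s x) ≡ x

module _ {A : Set} {s : A → A} {xs : List A} (inv : InvolutionOn s xs) where
  open InvolutionOn inv

  map-involution-↭ : map s xs ↭ xs
  map-involution-↭ = ∼bag⇒↭ (unique∧set⇒bag (unique-map injective distinct) distinct (mk⇔ to from))
    where
    injective : ∀ {a b} → a ∈ xs → b ∈ xs → s a ≡ s b → a ≡ b
    injective a∈xs b∈xs sa≡sb = trans (sym (involutive a∈xs)) (trans (cong s sa≡sb) (involutive b∈xs))
    to : ∀ {x} → x ∈ map s xs → x ∈ xs
    to x∈sxs with _ , y∈xs , refl ← ∈-map⁻ s x∈sxs = closed y∈xs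
    from : ∀ {x} → x ∈ xs → x ∈ map s xs
    from x∈xs = subst (_∈ map s xs) (involutive x∈xs) (∈-map⁺ s (closed x∈xs))

  sum-map-∘-involution : (st : A → ℕ) → sum (map (st ∘ s) xs) ≡ sum (map st xs)
  sum-map-∘-involution st = begin
    sum (map (st ∘ s) xs)   ≡⟨ cong sum (List.map-∘ xs) ⟩
    sum (map st (map s xs)) ≡⟨ sum-↭ (↭.map⁺ st map-involution-↭) ⟩
    sum (map st xs)         ∎
    where open ≡-Reasoning

  2*sum≡complement*length : (st : A → ℕ) (c : ℕ) → (∀ {x} → x ∈ xs → st (s x) + st x ≡ c) →
                            2 * sum (map st xs) ≡ c * length xs
  2*sum≡complement*length st c complement = begin
    2 * sum (map st xs)                     ≡⟨ cong (sum (map st xs) +_) (+-identityʳ _) ⟩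
    sum (map st xs) + sum (map st xs)       ≡⟨ cong (_+ sum (map st xs)) (sum-map-∘-involution st) ⟨
    sum (map (st ∘ s) xs) + sum (map st xs) ≡⟨ sum-map-+-const (st ∘ s) st c xs complement ⟩
    c * length xs                           ∎
    where open ≡-Reasoning

cross-mul-≡-from-halves : ∀ a b c m n → 2 * a ≡ c * m → 2 * b ≡ c * n → a * n ≡ b * m
cross-mul-≡-from-halves a b c m n 2a≡cm 2b≡cn = *-cancelˡ-≡ (a * n) (b * m) 2 (begin
  2 * (a * n) ≡⟨ *-assoc 2 a n ⟨
  2 * a * n   ≡⟨ cong (_* n) 2a≡cm ⟩
  c * m * n   ≡⟨ xy∙z≈xz∙y c m n ⟩
  c * n * m   ≡⟨ cong (_* m) 2b≡cn ⟨
  2 * b * m   ≡⟨ *-assoc 2 b m ⟩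
  2 * (b * m) ∎)
  where open ≡-Reasoning

module _ {n : ℕ} (P : SelfDualPoset n) (q : ℕ) where
  open SelfDualPoset P

  Bounded : Labeling P q → Set
  Bounded g = ∀ x → lookup g x ≤ suc q

  lookup-swap : ∀ g x → lookup (swap P q g) x ≡ suc q ∸ lookup g (κ x)
  lookup-swap g x = Vec.lookup∘tabulate _ x

  swap-bounded : ∀ g → Bounded (swap P q g)
  swap-bounded g x rewrite lookup-swap g x = m∸n≤m (suc q) (lookup g (κ x))

  swap-involutive : ∀ {g} → Bounded g → swap P q (swap P q g) ≡ g
  swap-involutive {g} g≤ = trans (Vec.tabulate-cong pointwise) (Vec.tabulate∘lookup g)
    where
    pointwise : ∀ x → suc q ∸ lookup (swap P q g) (κ x) ≡ lookup g x
    pointwise x rewrite lookup-swap g (κ x) | κ-invol x = m∸[m∸n]≡n (g≤ x)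

  swap-increasing : ∀ {g} → IsIncreasing P q g → IsIncreasing P q (swap P q g)
  swap-increasing {g} (inRange , increasing) = inRange′ , increasing′
    where
    inRange′ : ∀ x → (1 ≤ lookup (swap P q g) x) × (lookup (swap P q g) x ≤ q)
    inRange′ x rewrite lookup-swap g x =
      m<n⇒0<n∸m (s≤s (proj₂ (inRange (κ x)))) , ∸-monoʳ-≤ (suc q) (proj₁ (inRange (κ x)))
    increasing′ : ∀ x y → x ≺ y → lookup (swap P q g) x < lookup (swap P q g) y
    increasing′ x y x≺y rewrite lookup-swap g x | lookup-swap g y =
      ∸-monoʳ-< (increasing (κ y) (κ x) (κ-reverse x y x≺y)) (m≤n⇒m≤1+n (proj₂ (inRange (κ x))))

  antipodal-swap : ∀ x g → Bounded g →
                   antipodal P q x (swap P q g) + antipodal P q x g ≡ suc q + suc q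
  antipodal-swap x g g≤ rewrite lookup-swap g x | lookup-swap g (κ x) | κ-invol x = begin
    (suc q ∸ b) + (suc q ∸ a) + (a + b) ≡⟨ cong (suc q ∸ b + (suc q ∸ a) +_) (+-comm a b) ⟩
    (suc q ∸ b) + (suc q ∸ a) + (b + a) ≡⟨ interchange (suc q ∸ b) _ b a ⟩
    (suc q ∸ b + b) + (suc q ∸ a + a)   ≡⟨ cong₂ _+_ (m∸n+n≡m (g≤ (κ x))) (m∸n+n≡m (g≤ x)) ⟩
    suc q + suc q                       ∎
    where
    open ≡-Reasoning
    a = lookup g x
    b = lookup g (κ x)

  κ-involution : InvolutionOn κ (allFin n)
  κ-involution = record
    { distinct   = Unique.allFin⁺ n
    ; closed     = λ {x} _ → ∈-allFin (κ x)
    ; involutive = λ {x} _ → κ-invol x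
    }

  Tot≡sum-lookup : ∀ g → Tot P q g ≡ sum (map (lookup g) (allFin n))
  Tot≡sum-lookup g = cong sum (trans (toList≡tabulate-lookup g) (sym (List.map-tabulate id (lookup g))))

  Tot-swap : ∀ g → Bounded g → Tot P q (swap P q g) + Tot P q g ≡ suc q * n
  Tot-swap g g≤ = begin
    Tot P q (swap P q g) + Tot P q g
      ≡⟨ cong₂ _+_ (Tot≡sum-lookup (swap P q g)) (Tot≡sum-lookup g) ⟩
    sum (map (lookup (swap P q g)) (allFin n)) + sum (map (lookup g) (allFin n))
      ≡⟨ cong (_+ _) (sum-map-∘-involution κ-involution (lookup (swap P q g))) ⟨
    sum (map (lookup (swap P q g) ∘ κ) (allFin n)) + sum (map (lookup g) (allFin n))
      ≡⟨ sum-map-+-const _ _ (suc q) (allFin n) complement ⟩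
    suc q * length (allFin n)
      ≡⟨ cong (suc q *_) (List.length-tabulate id) ⟩
    suc q * n ∎
    where
    open ≡-Reasoning
    complement : ∀ {x} → x ∈ allFin n → lookup (swap P q g) (κ x) + lookup g x ≡ suc q
    complement {x} _ rewrite lookup-swap g (κ x) | κ-invol x = m∸n+n≡m (g≤ x)

  allLabelings-suc : ∀ m → allLabelings P q (suc m) ≡
                     cartesianProductWith _∷_ (map suc (upTo q)) (allLabelings P q m)
  allLabelings-suc m = concatMap-map≡cartesianProductWith _∷_ (map suc (upTo q)) (allLabelings P q m)

  allLabelings-distinct : ∀ m → Unique (allLabelings P q m)
  allLabelings-distinct zero    = All.[] ∷ []
  allLabelings-distinct (suc m) rewrite allLabelings-suc m =
    Unique.cartesianProductWith⁺ _∷_ Vec.∷-injective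
      (Unique.map⁺ suc-injective (Unique.upTo⁺ q)) (allLabelings-distinct m)

  ∈-allLabelings : ∀ {m} (v : Vec ℕ m) → (∀ x → (1 ≤ lookup v x) × (lookup v x ≤ q)) →
                   v ∈ allLabelings P q m
  ∈-allLabelings []         _       = here refl
  ∈-allLabelings (zero ∷ v) inRange with () ← proj₁ (inRange Fin.zero)
  ∈-allLabelings {suc m} (suc a ∷ v) inRange rewrite allLabelings-suc m =
    ∈-cartesianProductWith⁺ _∷_ (∈-map⁺ suc (∈-upTo⁺ (proj₂ (inRange Fin.zero))))
                                (∈-allLabelings v (inRange ∘ Fin.suc))

  ∈-Inc⁻ : ∀ {g} → g ∈ Inc P q → IsIncreasing P q g
  ∈-Inc⁻ g∈Inc = proj₂ (∈-filter⁻ (isIncreasing? P q) {xs = allLabelings P q n} g∈Inc)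

  Inc-bounded : ∀ {g} → g ∈ Inc P q → Bounded g
  Inc-bounded g∈Inc x = m≤n⇒m≤1+n (proj₂ (proj₁ (∈-Inc⁻ g∈Inc) x))

  Inc-involution : InvolutionOn (swap P q) (Inc P q)
  Inc-involution = record
    { distinct   = Unique.filter⁺ (isIncreasing? P q) (allLabelings-distinct n)
    ; closed     = λ {g} g∈Inc → let swapInc = swap-increasing {g} (∈-Inc⁻ g∈Inc) in
        ∈-filter⁺ (isIncreasing? P q) (∈-allLabelings (swap P q g) (proj₁ swapInc)) swapInc
    ; involutive = swap-involutive ∘ Inc-bounded
    }

  Pro^-+ : ∀ a b g → Pro^ P q (a + b) g ≡ Pro^ P q a (Pro^ P q b g)
  Pro^-+ zero    b g = refl
  Pro^-+ (suc a) b g = cong (Pro P q) (Pro^-+ a b g)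

  length-orbit : ∀ f p → length (orbit P q f p) ≡ p
  length-orbit f p = trans (List.length-map (λ k → Pro^ P q k f) (upTo p)) (List.length-upTo p)

  orbit-bounded : ∀ {f p g} → SwapClosed P q f → g ∈ orbit P q f p → Bounded g
  orbit-bounded (_ , isSwap) g∈O with ∈-map⁻ _ g∈O
  ... | k , _ , refl with isSwap k
  ... | j , Pro^k≡swap = subst Bounded (sym Pro^k≡swap) (swap-bounded (Pro^ P q j _))

  module _ {f p} (size : IsOrbitSize P q f p) where
    private
      instance
        p≢0 : NonZero p
        p≢0 = >-nonZero (proj₁ size)

      Pro^p≡id : Pro^ P q p f ≡ f
      Pro^p≡id = proj₁ (proj₂ size)

    Pro^-*-period : ∀ m → Pro^ P q (m * p) f ≡ f
    Pro^-*-period zero    = refl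
    Pro^-*-period (suc m) = begin
      Pro^ P q (p + m * p) f          ≡⟨ Pro^-+ p (m * p) f ⟩
      Pro^ P q p (Pro^ P q (m * p) f) ≡⟨ cong (Pro^ P q p) (Pro^-*-period m) ⟩
      Pro^ P q p f                    ≡⟨ Pro^p≡id ⟩
      f                               ∎
      where open ≡-Reasoning

    Pro^-%-period : ∀ j → Pro^ P q (j % p) f ≡ Pro^ P q j f
    Pro^-%-period j = begin
      Pro^ P q (j % p) f                        ≡⟨ cong (Pro^ P q (j % p)) (Pro^-*-period (j / p)) ⟨
      Pro^ P q (j % p) (Pro^ P q (j / p * p) f) ≡⟨ Pro^-+ (j % p) (j / p * p) f ⟨
      Pro^ P q (j % p + j / p * p) f            ≡⟨ cong (λ k → Pro^ P q k f) (m≡m%n+[m/n]*n j p) ⟨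
      Pro^ P q j f                              ∎
      where open ≡-Reasoning

    ∈-orbit : ∀ j → Pro^ P q j f ∈ orbit P q f p
    ∈-orbit j = subst (_∈ orbit P q f p) (Pro^-%-period j)
                      (∈-map⁺ (λ k → Pro^ P q k f) (∈-upTo⁺ (m%n<n j p)))

    Pro^-below-period-distinct : ∀ {i j} → i < j → j < p → Pro^ P q i f ≢ Pro^ P q j f
    Pro^-below-period-distinct {i} {j} i<j j<p Pro^i≡Pro^j =
      proj₂ (proj₂ size) (p ∸ j + i) 0<k k<p (begin
      Pro^ P q (p ∸ j + i) f          ≡⟨ Pro^-+ (p ∸ j) i f ⟩
      Pro^ P q (p ∸ j) (Pro^ P q i f) ≡⟨ cong (Pro^ P q (p ∸ j)) Pro^i≡Pro^j ⟩
      Pro^ P q (p ∸ j) (Pro^ P q j f) ≡⟨ Pro^-+ (p ∸ j) j f ⟨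
      Pro^ P q (p ∸ j + j) f          ≡⟨ cong (λ k → Pro^ P q k f) (m∸n+n≡m (<⇒≤ j<p)) ⟩
      Pro^ P q p f                    ≡⟨ Pro^p≡id ⟩
      f                               ∎)
      where
      open ≡-Reasoning
      0<k : 0 < p ∸ j + i
      0<k = ≤-trans (m<n⇒0<n∸m j<p) (m≤m+n (p ∸ j) i)
      k<p : p ∸ j + i < p
      k<p = subst (p ∸ j + i <_) (m∸n+n≡m (<⇒≤ j<p)) (+-monoʳ-< (p ∸ j) i<j)

    Pro^-injective-below-period : ∀ {i j} → i < p → j < p → Pro^ P q i f ≡ Pro^ P q j f → i ≡ j
    Pro^-injective-below-period {i} {j} i<p j<p Pro^i≡Pro^j with <-cmp i j
    ... | tri< i<j _ _ = ⊥-elim (Pro^-below-period-distinct i<j j<p Pro^i≡Pro^j)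
    ... | tri≈ _ i≡j _ = i≡j
    ... | tri> _ _ j<i = ⊥-elim (Pro^-below-period-distinct j<i i<p (sym Pro^i≡Pro^j))

    orbit-involution : SwapClosed P q f → InvolutionOn (swap P q) (orbit P q f p)
    orbit-involution closed = record
      { distinct   = unique-map injective (Unique.upTo⁺ p)
      ; closed     = swap-closed
      ; involutive = swap-involutive ∘ orbit-bounded closed
      }
      where
      injective : ∀ {i j} → i ∈ upTo p → j ∈ upTo p → Pro^ P q i f ≡ Pro^ P q j f → i ≡ j
      injective i∈ j∈ = Pro^-injective-below-period (∈-upTo⁻ i∈) (∈-upTo⁻ j∈)
      swap-closed : ∀ {g} → g ∈ orbit P q f p → swap P q g ∈ orbit P q f p
      swap-closed g∈O with ∈-map⁻ _ g∈O
      ... | k , _ , refl with proj₁ closed k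
      ... | j , swap≡Pro^j = subst (_∈ orbit P q f p) (sym swap≡Pro^j) (∈-orbit j)

  orbitmesic-of-complement : ∀ {f p} → IsOrbitSize P q f p → SwapClosed P q f →
                             (st : Labeling P q → ℕ) (c : ℕ) →
                             (∀ g → Bounded g → st (swap P q g) + st g ≡ c) →
                             Orbitmesic P q st f p
  orbitmesic-of-complement {f} {p} size closed st c complement =
    cross-mul-≡-from-halves (sum (map st (orbit P q f p))) (sum (map st (Inc P q)))
                            c p (length (Inc P q))
      (trans (2*sum≡complement*length (orbit-involution size closed) st c
                                      (λ {g} → complement g ∘ orbit-bounded closed))
             (cong (c *_) (length-orbit f p)))
      (2*sum≡complement*length Inc-involution st c (λ {g} → complement g ∘ Inc-bounded))

theorem5p14 : ∀ {n} (P : SelfDualPoset n) (q : ℕ) (f : Vec ℕ n) (p : ℕ)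
    → IsIncreasing P q f
    → IsOrbitSize P q f p
    → SwapClosed P q f
    → (∀ (x : Fin n) → Orbitmesic P q (antipodal P q x) f p)
      × Orbitmesic P q (Tot P q) f p
theorem5p14 {n} P q f p _ size closed =
    (λ x → orbitmesic-of-complement P q size closed
             (antipodal P q x) (suc q + suc q) (antipodal-swap P q x))
  , orbitmesic-of-complement P q size closed (Tot P q) (suc q * n) (Tot-swap P q)
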